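{- Let $n\ge1$. For every $J\subseteq\{0,1,\dots,n-1\}$, $$\varphi(Y_J)=\sum_{F\in\mathcal F_n,\ F\subseteq J\,\triangle\,(J+1)}2^{\#F}\,P_F,$$ where $\triangle$ is symmetric difference. In particular $\varphi$ maps $\Sigma(B_n)$ into $\Sigma(A_{n-1})$.
   Context: Type B: $\mathcal B_n$ is the group of signed permutations (bijections $w$ of $\{\pm1,\dots,\pm n\}$ with $w(-i)=-w(i)$), written $w_1\cdots w_n$, negative entries $-k$ written $\bar k$, ordered $\cdots<\bar2<\bar1<1<2<\cdots$. $\mathrm{Des}(w)=\{i\in\{0,\dots,n-1\}:w_i>w_{i+1}\}$ with $w_0=0$. $Y_J=\sum_{w\in\mathcal B_n,\mathrm{Des}(w)=J}w$, and $\Sigma(B_n)$ is the span of these. $\varphi:\mathbb Q\mathcal B_n\to\mathbb Q\mathcal S_n$ is the linear map forgetting signs, $w\mapsto|w_1|\cdots|w_n|$. $J+1=\{j+1:j\in J\}$. Type A: $\Sigma(A_{n-1})$ is Solomon's descent algebra of $\mathcal S_n$ (span of sums of permutations with a fixed descent set). For $u\in\mathcal S_n$, $\mathrm{Peak}(u)=\{i\in\{1,\dots,n-1\}:u_{i-1}<u_i>u_{i+1}\}$ with $u_0=0$. $\mathcal F_n$ is the set of subsets of $\{1,\dots,n-1\}$ with no two consecutive integers, and $P_F=\sum_{u\in\mathcal S_n,\mathrm{Peak}(u)=F}u$. -}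

module Defs where

open import Data.Bool using (Bool; true; false; _∧_; _∨_; _xor_; not; if_then_else_)
open import Data.Nat as ℕ using (ℕ; zero; suc; _^_; _<ᵇ_; _∸_)
open import Data.Integer as ℤ using (ℤ; +_; -[1+_])
open import Data.Rational using (ℚ; 0ℚ; 1ℚ; _+_; _*_; _/_)
open import Data.Fin using (Fin; toℕ)
open import Data.Fin.Subset using (Subset; ∣_∣)
open import Data.List as List using (List; []; _∷_; _++_; filter; concatMap; upTo; foldr)
open import Data.Vec as Vec using (Vec; []; _∷_; tabulate)
open import Data.Vec.Properties using (≡-dec)
open import Data.Product using (Σ; _×_; _,_; proj₁; proj₂)
open import Relation.Binary.PropositionalEquality using (_≡_)
open import Relation.Nullary using (does)
import Data.Nat.Properties as ℕP
import Data.Integer.Properties as ℤP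
import Data.Bool.Properties as BP

-- Words.  A permutation u ∈ S_n is the word u₁⋯uₙ (a Vec ℕ n), a signed
-- permutation w ∈ B_n is the word w₁⋯wₙ (a Vec ℤ n).

-- 1-indexed lookup with the convention x₀ = 0 (and 0 out of range).
atℕ : {n : ℕ} → Vec ℕ n → ℕ → ℕ
atℕ v zero = 0
atℕ [] (suc k) = 0
atℕ (x ∷ xs) (suc zero) = x
atℕ (x ∷ xs) (suc (suc k)) = atℕ xs (suc k)

atℤ : {n : ℕ} → Vec ℤ n → ℕ → ℤ
atℤ v zero = + 0
atℤ [] (suc k) = + 0
atℤ (x ∷ xs) (suc zero) = x
atℤ (x ∷ xs) (suc (suc k)) = atℤ xs (suc k)

_<ℤᵇ_ : ℤ → ℤ → Bool
x <ℤᵇ y = does (x ℤ.<? y)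

elemᵇ : ℕ → List ℕ → Bool
elemᵇ k [] = false
elemᵇ k (x ∷ xs) = does (k ℕ.≟ x) ∨ elemᵇ k xs

allᵇ : {A : Set} → (A → Bool) → List A → Bool
allᵇ p [] = true
allᵇ p (x ∷ xs) = p x ∧ allᵇ p xs

oneTo : ℕ → List ℕ
oneTo n = List.map suc (upTo n)

allVecs : {A : Set} → List A → (n : ℕ) → List (Vec A n)
allVecs as zero = [] ∷ []
allVecs as (suc n) = concatMap (λ a → List.map (a ∷_) (allVecs as n)) as

isPerm : {n : ℕ} → Vec ℕ n → Bool
isPerm {n} u = allᵇ (λ k → elemᵇ k (Vec.toList u)) (oneTo n)

Sn : (n : ℕ) → List (Vec ℕ n)
Sn n = filter (λ u → BP.T? (isPerm u)) (allVecs (oneTo n) n)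

-- w ∈ {±1..±n}^n is a signed permutation iff |w₁|⋯|wₙ| is a permutation
-- (the condition w(-i) = -w(i) is built into the word notation).
absVec : {n : ℕ} → Vec ℤ n → Vec ℕ n
absVec = Vec.map ℤ.∣_∣

signedLetters : ℕ → List ℤ
signedLetters n = List.map (λ k → + k) (oneTo n) ++ List.map (λ k → -[1+ k ]) (upTo n)

Bn : (n : ℕ) → List (Vec ℤ n)
Bn n = filter (λ w → BP.T? (isPerm (absVec w))) (allVecs (signedLetters n) n)

-- Subsets: a subset of {0,…,n-1} is a Subset n = Vec Bool n, position i
-- (i : Fin n) standing for the integer toℕ i.

allSubsets : (n : ℕ) → List (Subset n)
allSubsets = allVecs (false ∷ true ∷ [])

-- type B descent set, with w₀ = 0:  i ∈ Des(w) iff wᵢ > wᵢ₊₁, 0 ≤ i ≤ n-1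
DesB : {n : ℕ} → Vec ℤ n → Subset n
DesB w = tabulate (λ i → atℤ w (suc (toℕ i)) <ℤᵇ atℤ w (toℕ i))

DesA : {n : ℕ} → Vec ℕ n → Subset n
DesA u = tabulate (λ i → (1 ℕ.≤ᵇ toℕ i) ∧ (atℕ u (suc (toℕ i)) <ᵇ atℕ u (toℕ i)))

Peak : {n : ℕ} → Vec ℕ n → Subset n
Peak u = tabulate (λ i → (1 ℕ.≤ᵇ toℕ i)
                      ∧ (atℕ u (toℕ i ∸ 1) <ᵇ atℕ u (toℕ i))
                      ∧ (atℕ u (suc (toℕ i)) <ᵇ atℕ u (toℕ i)))

-- J + 1 = {j+1 : j ∈ J}, intersected with {0,…,n-1}
shift : {n : ℕ} → Subset n → Subset n
shift [] = []
shift (b ∷ bs) = false ∷ Vec.init (b ∷ bs)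

_△_ : {n : ℕ} → Subset n → Subset n → Subset n
_△_ = Vec.zipWith _xor_

_⊆ᵇ_ : {n : ℕ} → Subset n → Subset n → Bool
[] ⊆ᵇ [] = true
(a ∷ as) ⊆ᵇ (b ∷ bs) = (not a ∨ b) ∧ (as ⊆ᵇ bs)

noConsec : {n : ℕ} → Subset n → Bool
noConsec [] = true
noConsec (a ∷ []) = true
noConsec (a ∷ b ∷ bs) = not (a ∧ b) ∧ noConsec (b ∷ bs)

-- F ∈ 𝓕ₙ : F ⊆ {1,…,n-1} (i.e. 0 ∉ F) with no two consecutive integers
inFn : {n : ℕ} → Subset n → Bool
inFn [] = true
inFn (a ∷ as) = not a ∧ noConsec (a ∷ as)

Formal : Set → Set
Formal W = List (ℚ × W)

QSn : ℕ → Set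
QSn n = Formal (Vec ℕ n)

QBn : ℕ → Set
QBn n = Formal (Vec ℤ n)

coeffA : {n : ℕ} → QSn n → Vec ℕ n → ℚ
coeffA [] u = 0ℚ
coeffA ((c , v) ∷ x) u = (if does (≡-dec ℕ._≟_ v u) then c else 0ℚ) + coeffA x u

_≈A_ : {n : ℕ} → QSn n → QSn n → Set
x ≈A y = ∀ u → coeffA x u ≡ coeffA y u

scale : {W : Set} → ℚ → Formal W → Formal W
scale c = List.map (λ p → c * proj₁ p , proj₂ p)

sumF : {W A : Set} → List A → (A → Formal W) → Formal W
sumF as f = concatMap f as

sumOf : {W : Set} → List W → Formal W
sumOf = List.map (λ w → 1ℚ , w)

φ : {n : ℕ} → QBn n → QSn n
φ = List.map (λ p → proj₁ p , absVec (proj₂ p))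

Y : {n : ℕ} → Subset n → QBn n
Y {n} J = sumOf (filter (λ w → ≡-dec BP._≟_ (DesB w) J) (Bn n))

D : {n : ℕ} → Subset n → QSn n
D {n} K = sumOf (filter (λ u → ≡-dec BP._≟_ (DesA u) K) (Sn n))

P : {n : ℕ} → Subset n → QSn n
P {n} F = sumOf (filter (λ u → ≡-dec BP._≟_ (Peak u) F) (Sn n))

ℚ-ofℕ : ℕ → ℚ
ℚ-ofℕ k = + k / 1

peakRHS : {n : ℕ} → Subset n → QSn n
peakRHS {n} J =
  sumF (filter (λ F → BP.T? (inFn F ∧ (F ⊆ᵇ (J △ shift J)))) (allSubsets n))
       (λ F → scale (ℚ-ofℕ (2 ^ ∣ F ∣)) (P F))

-- Σ(B_n): the span of the Y_J ; Σ(A_{n-1}): the span of the D_K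
ΣB-elem : {n : ℕ} → (Subset n → ℚ) → QBn n
ΣB-elem {n} a = sumF (allSubsets n) (λ J → scale (a J) (Y J))

InΣA : {n : ℕ} → QSn n → Set
InΣA {n} x = Σ (Subset n → ℚ) (λ c → x ≈A sumF (allSubsets n) (λ K → scale (c K) (D K)))

{-# OPTIONS --safe #-}
-- Fix a permutation u and read a signed permutation w with |w| = u from left
-- to right, starting from w₀ = 0.  Whether i ∈ Des(w) depends only on the sign
-- of the letter of larger absolute value among wᵢ, wᵢ₊₁.  So a letter entered
-- by an ascent of u has its sign forced by J, while a letter entered by a
-- descent has a free sign, which the next descent (if any) forces in turn.  At
-- a peak i both constraints fall on the same letter, and they are consistent
-- exactly when i ∈ J △ (J+1); each descending run starting at a peak keeps one
-- free sign.  Hence u has 2^#Peak(u) lifts with descent set J if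
-- Peak(u) ⊆ J △ (J+1) and none otherwise, which is its coefficient on the
-- right-hand side.  A permutation has no equal adjacent letters, so Peak(u) is
-- determined by Des(u), and φ maps Σ(B_n) into the span of Solomon's basis.

module Submission where

open import Defs
open import Algebra.Bundles using (CommutativeMonoid)
open import Data.Bool as Bool using (Bool; true; false; _∧_; _xor_; not; if_then_else_)
import Data.Bool.Properties as Bool
open import Data.Fin as Fin using (Fin; toℕ)
import Data.Fin.Properties as Fin
open import Data.Fin.Subset using (Subset; ∣_∣)
open import Data.Integer as ℤ using (ℤ; +_; -[1+_])
import Data.Integer.Properties as ℤ
open import Data.List as List using (List; []; _∷_; _++_; concatMap; filter; length; upTo)
import Data.List.Properties as List
open import Data.List.Membership.Propositional using (_∈_)
open import Data.List.Membership.Propositional.Properties using (∈-map⁺; ∈-upTo⁺)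
open import Data.List.Relation.Binary.Subset.Propositional using (_⊆_)
open import Data.List.Relation.Unary.Any using (here; there; index)
open import Data.List.Relation.Unary.Any.Properties using (lookup-index)
open import Data.List.Relation.Unary.Linked using (Linked; [-]; _∷_)
open import Data.Nat as ℕ using (ℕ; zero; suc; _+_; _*_; _^_; _∸_; _<ᵇ_; _<_; _≤_; s<s)
import Data.Nat.Properties as ℕ
open import Data.Product using (Σ; _×_; _,_)
open import Data.Rational as ℚ using (ℚ; 0ℚ; 1ℚ; toℚᵘ)
import Data.Rational.Properties as ℚ
open import Data.Rational.Unnormalised as ℚᵘ using (mkℚᵘ; *≡*)
import Data.Rational.Unnormalised.Properties as ℚᵘ
open import Data.Sum using (_⊎_; inj₁; inj₂)
open import Data.Vec as Vec using (Vec; []; _∷_; tabulate; toList)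
open import Data.Vec.Properties using (≡-dec; tabulate-cong; length-toList)
open import Function.Bundles using (Equivalence)
open import Relation.Binary.Definitions using (DecidableEquality; tri<; tri≈; tri>)
open import Relation.Binary.PropositionalEquality
open import Relation.Nullary using (does; yes; no; contradiction)
open import Relation.Nullary.Decidable using (T?; dec-true; dec-false)
open import Relation.Unary using (Decidable)

import Algebra.Properties.CommutativeSemigroup ℕ.*-commutativeSemigroup as ℕ*
import Algebra.Properties.CommutativeSemigroup (CommutativeMonoid.commutativeSemigroup ℚ.*-1-commutativeMonoid) as ℚ*

private
  variable
    A B : Set
    k m : ℕ

toℚᵘ-ℚ-ofℕ : ∀ k → toℚᵘ (ℚ-ofℕ k) ℚᵘ.≃ mkℚᵘ (+ k) 0
toℚᵘ-ℚ-ofℕ k = ℚ.toℚᵘ-fromℚᵘ (mkℚᵘ (+ k) 0)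

ℚ-ofℕ-+ : ∀ a b → ℚ-ofℕ (a + b) ≡ ℚ-ofℕ a ℚ.+ ℚ-ofℕ b
ℚ-ofℕ-+ a b = ℚ.toℚᵘ-injective (begin
  toℚᵘ (ℚ-ofℕ (a + b))                 ≈⟨ toℚᵘ-ℚ-ofℕ (a + b) ⟩
  mkℚᵘ (+ (a + b)) 0                   ≈⟨ *≡* (cong (ℤ._* + 1) (trans (ℤ.pos-+ a b)
                                             (sym (cong₂ ℤ._+_ (ℤ.*-identityʳ (+ a)) (ℤ.*-identityʳ (+ b)))))) ⟩
  mkℚᵘ (+ a) 0 ℚᵘ.+ mkℚᵘ (+ b) 0       ≈⟨ ℚᵘ.≃-sym (ℚᵘ.+-cong (toℚᵘ-ℚ-ofℕ a) (toℚᵘ-ℚ-ofℕ b)) ⟩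
  toℚᵘ (ℚ-ofℕ a) ℚᵘ.+ toℚᵘ (ℚ-ofℕ b)  ≈⟨ ℚᵘ.≃-sym (ℚ.toℚᵘ-homo-+ (ℚ-ofℕ a) (ℚ-ofℕ b)) ⟩
  toℚᵘ (ℚ-ofℕ a ℚ.+ ℚ-ofℕ b)          ∎)
  where open ℚᵘ.≃-Reasoning

ℚ-ofℕ-* : ∀ a b → ℚ-ofℕ (a * b) ≡ ℚ-ofℕ a ℚ.* ℚ-ofℕ b
ℚ-ofℕ-* a b = ℚ.toℚᵘ-injective (begin
  toℚᵘ (ℚ-ofℕ (a * b))                 ≈⟨ toℚᵘ-ℚ-ofℕ (a * b) ⟩
  mkℚᵘ (+ (a * b)) 0                   ≈⟨ *≡* (cong (ℤ._* + 1) (ℤ.pos-* a b)) ⟩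
  mkℚᵘ (+ a) 0 ℚᵘ.* mkℚᵘ (+ b) 0       ≈⟨ ℚᵘ.≃-sym (ℚᵘ.*-cong (toℚᵘ-ℚ-ofℕ a) (toℚᵘ-ℚ-ofℕ b)) ⟩
  toℚᵘ (ℚ-ofℕ a) ℚᵘ.* toℚᵘ (ℚ-ofℕ b)  ≈⟨ ℚᵘ.≃-sym (ℚ.toℚᵘ-homo-* (ℚ-ofℕ a) (ℚ-ofℕ b)) ⟩
  toℚᵘ (ℚ-ofℕ a ℚ.* ℚ-ofℕ b)          ∎)
  where open ℚᵘ.≃-Reasoning


⟦_⟧ : Bool → ℕ
⟦ true ⟧ = 1
⟦ false ⟧ = 0

⟦⟧-∧ : ∀ a b → ⟦ a ∧ b ⟧ ≡ ⟦ a ⟧ * ⟦ b ⟧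
⟦⟧-∧ true b = sym (ℕ.*-identityˡ ⟦ b ⟧)
⟦⟧-∧ false b = refl

∑ : List A → (A → ℕ) → ℕ
∑ [] f = 0
∑ (x ∷ xs) f = f x + ∑ xs f

infix 5 ∑
syntax ∑ xs (λ x → e) = ∑[ x ∈ xs ] e

∑-cong : {f g : A → ℕ} → (∀ x → f x ≡ g x) → (xs : List A) → ∑ xs f ≡ ∑ xs g
∑-cong f≗g [] = refl
∑-cong f≗g (x ∷ xs) = cong₂ _+_ (f≗g x) (∑-cong f≗g xs)

∑-++ : (xs ys : List A) (f : A → ℕ) → ∑ (xs ++ ys) f ≡ ∑ xs f + ∑ ys f
∑-++ [] ys f = refl
∑-++ (x ∷ xs) ys f = trans (cong (_+_ (f x)) (∑-++ xs ys f)) (sym (ℕ.+-assoc (f x) _ _))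

∑-map : (g : A → B) (xs : List A) (f : B → ℕ) → ∑ (List.map g xs) f ≡ ∑[ x ∈ xs ] f (g x)
∑-map g [] f = refl
∑-map g (x ∷ xs) f = cong (_+_ (f (g x))) (∑-map g xs f)

∑-concatMap : (g : A → List B) (xs : List A) (f : B → ℕ) → ∑ (concatMap g xs) f ≡ ∑[ x ∈ xs ] ∑ (g x) f
∑-concatMap g [] f = refl
∑-concatMap g (x ∷ xs) f = trans (∑-++ (g x) (concatMap g xs) f) (cong (_+_ (∑ (g x) f)) (∑-concatMap g xs f))

∑-filter : {P : A → Set} (P? : Decidable P) (xs : List A) (f : A → ℕ) → ∑ (filter P? xs) f ≡ ∑[ x ∈ xs ] ⟦ does (P? x) ⟧ * f x
∑-filter P? [] f = refl
∑-filter P? (x ∷ xs) f with does (P? x)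
... | true = cong₂ _+_ (sym (ℕ.+-identityʳ (f x))) (∑-filter P? xs f)
... | false = ∑-filter P? xs f

∑-*ˡ : ∀ c (xs : List A) (f : A → ℕ) → ∑[ x ∈ xs ] c * f x ≡ c * ∑ xs f
∑-*ˡ c [] f = sym (ℕ.*-zeroʳ c)
∑-*ˡ c (x ∷ xs) f = trans (cong (_+_ (c * f x)) (∑-*ˡ c xs f)) (sym (ℕ.*-distribˡ-+ c (f x) _))

∑-*ʳ : ∀ c (xs : List A) (f : A → ℕ) → ∑[ x ∈ xs ] f x * c ≡ ∑ xs f * c
∑-*ʳ c xs f = trans (∑-cong (λ x → ℕ.*-comm (f x) c) xs) (trans (∑-*ˡ c xs f) (ℕ.*-comm c _))

∑-allVecs : (as : List A) (k : ℕ) (f : Vec A (suc k) → ℕ) →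
  ∑ (allVecs as (suc k)) f ≡ ∑[ a ∈ as ] ∑[ w ∈ allVecs as k ] f (a ∷ w)
∑-allVecs as k f = trans (∑-concatMap _ as f) (∑-cong (λ a → ∑-map (a ∷_) (allVecs as k) f) as)

occurrences : DecidableEquality A → List A → A → ℕ
occurrences _≟_ xs y = ∑[ x ∈ xs ] ⟦ does (x ≟ y) ⟧

≟-select : (_≟_ : DecidableEquality A) (g : A → ℕ) (x y : A) → ⟦ does (x ≟ y) ⟧ * g x ≡ ⟦ does (x ≟ y) ⟧ * g y
≟-select _≟_ g x y with x ≟ y
... | yes refl = refl
... | no _ = refl

≟-sym : (_≟_ : DecidableEquality A) (x y : A) → does (x ≟ y) ≡ does (y ≟ x)
≟-sym _≟_ x y with x ≟ y | y ≟ x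
... | yes _ | yes _ = refl
... | no _ | no _ = refl
... | yes x≡y | no y≢x = contradiction (sym x≡y) y≢x
... | no x≢y | yes y≡x = contradiction (sym y≡x) x≢y

∑-select : (_≟_ : DecidableEquality A) (xs : List A) (y : A) (g : A → ℕ) →
  ∑[ x ∈ xs ] ⟦ does (x ≟ y) ⟧ * g x ≡ occurrences _≟_ xs y * g y
∑-select _≟_ xs y g = trans (∑-cong (λ x → ≟-select _≟_ g x y) xs) (∑-*ʳ (g y) xs _)

occurrences-filter : (_≟_ : DecidableEquality A) {P : A → Set} (P? : Decidable P) (xs : List A) (y : A) →
  occurrences _≟_ (filter P? xs) y ≡ ⟦ does (P? y) ⟧ * occurrences _≟_ xs y
occurrences-filter _≟_ P? xs y = begin
  occurrences _≟_ (filter P? xs) y                  ≡⟨ ∑-filter P? xs _ ⟩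
  ∑[ x ∈ xs ] ⟦ does (P? x) ⟧ * ⟦ does (x ≟ y) ⟧   ≡⟨ ∑-cong select xs ⟩
  ∑[ x ∈ xs ] ⟦ does (P? y) ⟧ * ⟦ does (x ≟ y) ⟧   ≡⟨ ∑-*ˡ ⟦ does (P? y) ⟧ xs _ ⟩
  ⟦ does (P? y) ⟧ * occurrences _≟_ xs y            ∎
  where
  open ≡-Reasoning
  select : ∀ x → ⟦ does (P? x) ⟧ * ⟦ does (x ≟ y) ⟧ ≡ ⟦ does (P? y) ⟧ * ⟦ does (x ≟ y) ⟧
  select x = begin
    ⟦ does (P? x) ⟧ * ⟦ does (x ≟ y) ⟧  ≡⟨ ℕ.*-comm ⟦ does (P? x) ⟧ _ ⟩
    ⟦ does (x ≟ y) ⟧ * ⟦ does (P? x) ⟧  ≡⟨ ≟-select _≟_ (λ x → ⟦ does (P? x) ⟧) x y ⟩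
    ⟦ does (x ≟ y) ⟧ * ⟦ does (P? y) ⟧  ≡⟨ ℕ.*-comm ⟦ does (x ≟ y) ⟧ _ ⟩
    ⟦ does (P? y) ⟧ * ⟦ does (x ≟ y) ⟧  ∎

occurrences-allVecs : (_≟_ : DecidableEquality A) (as : List A) (k : ℕ) (x : A) (v : Vec A k) →
  occurrences (≡-dec _≟_) (allVecs as (suc k)) (x ∷ v)
    ≡ occurrences _≟_ as x * occurrences (≡-dec _≟_) (allVecs as k) v
occurrences-allVecs _≟_ as k x v = begin
  occurrences (≡-dec _≟_) (allVecs as (suc k)) (x ∷ v)
    ≡⟨ ∑-allVecs as k _ ⟩
  ∑[ a ∈ as ] ∑[ w ∈ allVecs as k ] ⟦ does (a ≟ x) ∧ does (≡-dec _≟_ w v) ⟧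
    ≡⟨ ∑-cong (λ a → trans (∑-cong (λ w → ⟦⟧-∧ (does (a ≟ x)) _) (allVecs as k))
                           (∑-*ˡ ⟦ does (a ≟ x) ⟧ (allVecs as k) _)) as ⟩
  ∑[ a ∈ as ] ⟦ does (a ≟ x) ⟧ * occurrences (≡-dec _≟_) (allVecs as k) v
    ≡⟨ ∑-*ʳ (occurrences (≡-dec _≟_) (allVecs as k) v) as _ ⟩
  occurrences _≟_ as x * occurrences (≡-dec _≟_) (allVecs as k) v
    ∎
  where open ≡-Reasoning

_≟ˢ_ : DecidableEquality (Subset k)
_≟ˢ_ = ≡-dec Bool._≟_

_≟ʷ_ : DecidableEquality (Vec ℕ k)
_≟ʷ_ = ≡-dec ℕ._≟_

occurrences-allSubsets : (k : ℕ) (v : Subset k) → occurrences _≟ˢ_ (allSubsets k) v ≡ 1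
occurrences-allSubsets zero [] = refl
occurrences-allSubsets (suc k) (b ∷ v) =
  trans (occurrences-allVecs Bool._≟_ (false ∷ true ∷ []) k b v)
        (cong₂ _*_ (once b) (occurrences-allSubsets k v))
  where
  once : ∀ b → occurrences Bool._≟_ (false ∷ true ∷ []) b ≡ 1
  once false = refl
  once true = refl

allSubsets-once : (v : Subset k) → ∑[ F ∈ allSubsets k ] ⟦ does (v ≟ˢ F) ⟧ ≡ 1
allSubsets-once {k} v =
  trans (∑-cong (λ F → cong ⟦_⟧ (≟-sym _≟ˢ_ v F)) (allSubsets k)) (occurrences-allSubsets k v)

allSubsets-select : (v : Subset k) (g : Subset k → ℕ) →
  ∑[ F ∈ allSubsets k ] ⟦ does (v ≟ˢ F) ⟧ * g F ≡ g v
allSubsets-select {k} v g = begin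
  ∑[ F ∈ allSubsets k ] ⟦ does (v ≟ˢ F) ⟧ * g F    ≡⟨ ∑-cong (λ F → sym (≟-select _≟ˢ_ g v F)) (allSubsets k) ⟩
  ∑[ F ∈ allSubsets k ] ⟦ does (v ≟ˢ F) ⟧ * g v    ≡⟨ ∑-*ʳ (g v) (allSubsets k) _ ⟩
  (∑[ F ∈ allSubsets k ] ⟦ does (v ≟ˢ F) ⟧) * g v  ≡⟨ cong (_* g v) (allSubsets-once v) ⟩
  1 * g v                                          ≡⟨ ℕ.*-identityˡ (g v) ⟩
  g v                                              ∎
  where open ≡-Reasoning

∑ℚ : List A → (A → ℚ) → ℚ
∑ℚ [] f = 0ℚ
∑ℚ (x ∷ xs) f = f x ℚ.+ ∑ℚ xs f

infix 5 ∑ℚ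
syntax ∑ℚ xs (λ x → e) = ∑ℚ[ x ∈ xs ] e

∑ℚ-cong : {f g : A → ℚ} → (∀ x → f x ≡ g x) → (xs : List A) → ∑ℚ xs f ≡ ∑ℚ xs g
∑ℚ-cong f≗g [] = refl
∑ℚ-cong f≗g (x ∷ xs) = cong₂ ℚ._+_ (f≗g x) (∑ℚ-cong f≗g xs)

∑ℚ-*ʳ : ∀ c (xs : List A) (f : A → ℚ) → ∑ℚ[ x ∈ xs ] f x ℚ.* c ≡ ∑ℚ xs f ℚ.* c
∑ℚ-*ʳ c [] f = sym (ℚ.*-zeroˡ c)
∑ℚ-*ʳ c (x ∷ xs) f = trans (cong (ℚ._+_ (f x ℚ.* c)) (∑ℚ-*ʳ c xs f)) (sym (ℚ.*-distribʳ-+ c (f x) _))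

∑ℚ-ofℕ : (xs : List A) (f : A → ℕ) → ∑ℚ[ x ∈ xs ] ℚ-ofℕ (f x) ≡ ℚ-ofℕ (∑ xs f)
∑ℚ-ofℕ [] f = refl
∑ℚ-ofℕ (x ∷ xs) f = trans (cong (ℚ._+_ (ℚ-ofℕ (f x))) (∑ℚ-ofℕ xs f)) (sym (ℚ-ofℕ-+ (f x) _))

allSubsets-selectℚ : (v : Subset k) (g : Subset k → ℚ) →
  ∑ℚ[ F ∈ allSubsets k ] ℚ-ofℕ ⟦ does (v ≟ˢ F) ⟧ ℚ.* g F ≡ g v
allSubsets-selectℚ {k} v g = begin
  ∑ℚ[ F ∈ allSubsets k ] ℚ-ofℕ ⟦ does (v ≟ˢ F) ⟧ ℚ.* g F    ≡⟨ ∑ℚ-cong select (allSubsets k) ⟩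
  ∑ℚ[ F ∈ allSubsets k ] ℚ-ofℕ ⟦ does (v ≟ˢ F) ⟧ ℚ.* g v    ≡⟨ ∑ℚ-*ʳ (g v) (allSubsets k) _ ⟩
  (∑ℚ[ F ∈ allSubsets k ] ℚ-ofℕ ⟦ does (v ≟ˢ F) ⟧) ℚ.* g v  ≡⟨ cong (ℚ._* g v) (∑ℚ-ofℕ (allSubsets k) _) ⟩
  ℚ-ofℕ (∑[ F ∈ allSubsets k ] ⟦ does (v ≟ˢ F) ⟧) ℚ.* g v  ≡⟨ cong (λ m → ℚ-ofℕ m ℚ.* g v) (allSubsets-once v) ⟩
  ℚ-ofℕ 1 ℚ.* g v                                          ≡⟨ ℚ.*-identityˡ (g v) ⟩
  g v                                                      ∎
  where
  open ≡-Reasoning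
  select : ∀ F → ℚ-ofℕ ⟦ does (v ≟ˢ F) ⟧ ℚ.* g F ≡ ℚ-ofℕ ⟦ does (v ≟ˢ F) ⟧ ℚ.* g v
  select F with v ≟ˢ F
  ... | yes refl = refl
  ... | no _ = trans (ℚ.*-zeroˡ (g F)) (sym (ℚ.*-zeroˡ (g v)))


module _ {n : ℕ} where

  coeffA-++ : (x y : QSn n) (u : Vec ℕ n) → coeffA (x ++ y) u ≡ coeffA x u ℚ.+ coeffA y u
  coeffA-++ [] y u = sym (ℚ.+-identityˡ _)
  coeffA-++ ((c , v) ∷ x) y u =
    trans (cong (ℚ._+_ cᵥ) (coeffA-++ x y u)) (sym (ℚ.+-assoc cᵥ (coeffA x u) _))
    where cᵥ = if does (v ≟ʷ u) then c else 0ℚ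

  coeffA-sumF : (xs : List A) (f : A → QSn n) (u : Vec ℕ n) → coeffA (sumF xs f) u ≡ ∑ℚ[ a ∈ xs ] coeffA (f a) u
  coeffA-sumF [] f u = refl
  coeffA-sumF (x ∷ xs) f u = trans (coeffA-++ (f x) (sumF xs f) u) (cong (ℚ._+_ (coeffA (f x) u)) (coeffA-sumF xs f u))

  coeffA-scale : (c : ℚ) (x : QSn n) (u : Vec ℕ n) → coeffA (scale c x) u ≡ c ℚ.* coeffA x u
  coeffA-scale c [] u = sym (ℚ.*-zeroʳ c)
  coeffA-scale c ((d , v) ∷ x) u =
    trans (cong₂ ℚ._+_ (if-scale (does (v ≟ʷ u))) (coeffA-scale c x u)) (sym (ℚ.*-distribˡ-+ c _ _))
    where
    if-scale : ∀ b → (if b then c ℚ.* d else 0ℚ) ≡ c ℚ.* (if b then d else 0ℚ)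
    if-scale true = refl
    if-scale false = sym (ℚ.*-zeroʳ c)

  coeffA-sumOf : (vs : List (Vec ℕ n)) (u : Vec ℕ n) → coeffA (sumOf vs) u ≡ ℚ-ofℕ (occurrences _≟ʷ_ vs u)
  coeffA-sumOf [] u = refl
  coeffA-sumOf (v ∷ vs) u =
    trans (cong₂ ℚ._+_ (if-1 (does (v ≟ʷ u))) (coeffA-sumOf vs u)) (sym (ℚ-ofℕ-+ ⟦ does (v ≟ʷ u) ⟧ _))
    where
    if-1 : ∀ b → (if b then 1ℚ else 0ℚ) ≡ ℚ-ofℕ ⟦ b ⟧
    if-1 true = refl
    if-1 false = refl

  φ-sumOf : (ws : List (Vec ℤ n)) → φ (sumOf ws) ≡ sumOf (List.map absVec ws)
  φ-sumOf ws = trans (sym (List.map-∘ ws)) (List.map-∘ ws)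

  φ-scale : (c : ℚ) (x : QBn n) → φ (scale c x) ≡ scale c (φ x)
  φ-scale c x = trans (sym (List.map-∘ x)) (List.map-∘ x)

  φ-sumF : (xs : List A) (f : A → QBn n) → φ (sumF xs f) ≡ sumF xs (λ a → φ (f a))
  φ-sumF xs f = List.map-concatMap _ f xs

  coeffA-combination : (xs : List A) (c : A → ℚ) (x : A → QSn n) (u : Vec ℕ n) →
    coeffA (sumF xs (λ a → scale (c a) (x a))) u ≡ ∑ℚ[ a ∈ xs ] c a ℚ.* coeffA (x a) u
  coeffA-combination xs c x u = trans (coeffA-sumF xs _ u) (∑ℚ-cong (λ a → coeffA-scale (c a) (x a) u) xs)

  φ-combination : (xs : List A) (c : A → ℚ) (y : A → QBn n) →
    φ (sumF xs (λ a → scale (c a) (y a))) ≡ sumF xs (λ a → scale (c a) (φ (y a)))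
  φ-combination xs c y = trans (φ-sumF xs _) (List.concatMap-cong (λ a → φ-scale (c a) (y a)) xs)


-- Descents and peaks of words

<ᵇ-true : ∀ {m n} → m < n → (m <ᵇ n) ≡ true
<ᵇ-true {m} {n} = dec-true (m ℕ.<? n)

<ᵇ-false : ∀ {m n} → n ≤ m → (m <ᵇ n) ≡ false
<ᵇ-false {m} {n} n≤m = dec-false (m ℕ.<? n) (ℕ.≤⇒≯ n≤m)

letter : A → A → Vec A k → ℕ → A
letter d p u zero = p
letter d p [] (suc t) = d
letter d p (x ∷ u) (suc t) = letter d x u t

letter-suc : (d p q : A) (u : Vec A k) (t : ℕ) → letter d p u (suc t) ≡ letter d q u (suc t)
letter-suc d p q [] t = refl
letter-suc d p q (x ∷ u) t = refl

atℕ-letter : (u : Vec ℕ k) (t : ℕ) → atℕ u t ≡ letter 0 0 u t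
atℕ-letter u zero = refl
atℕ-letter [] (suc t) = refl
atℕ-letter (x ∷ u) (suc zero) = refl
atℕ-letter (x ∷ u) (suc (suc t)) = trans (atℕ-letter u (suc t)) (letter-suc 0 0 x u t)

atℤ-letter : (w : Vec ℤ k) (t : ℕ) → atℤ w t ≡ letter (+ 0) (+ 0) w t
atℤ-letter w zero = refl
atℤ-letter [] (suc t) = refl
atℤ-letter (x ∷ w) (suc zero) = refl
atℤ-letter (x ∷ w) (suc (suc t)) = trans (atℤ-letter w (suc t)) (letter-suc (+ 0) (+ 0) x w t)

descentsAfter : (A → A → Bool) → A → Vec A k → Vec Bool k
descentsAfter _<_ p [] = []
descentsAfter _<_ p (x ∷ u) = (x < p) ∷ descentsAfter _<_ x u

descentsAfter-tabulate : (_<_ : A → A → Bool) (d p : A) (u : Vec A k) →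
  descentsAfter _<_ p u ≡ tabulate (λ i → letter d p u (suc (toℕ i)) < letter d p u (toℕ i))
descentsAfter-tabulate _<_ d p [] = refl
descentsAfter-tabulate _<_ d p (x ∷ u) = cong (_ ∷_) (descentsAfter-tabulate _<_ d x u)

DesB-descentsAfter : (w : Vec ℤ k) → DesB w ≡ descentsAfter _<ℤᵇ_ (+ 0) w
DesB-descentsAfter w =
  trans (tabulate-cong (λ i → cong₂ _<ℤᵇ_ (atℤ-letter w (suc (toℕ i))) (atℤ-letter w (toℕ i))))
        (sym (descentsAfter-tabulate _<ℤᵇ_ (+ 0) (+ 0) w))

DesA-descentsAfter : (u : Vec ℕ k) → DesA u ≡ descentsAfter _<ᵇ_ 0 u
DesA-descentsAfter u =
  trans (tabulate-cong (λ i → entry (toℕ i))) (sym (descentsAfter-tabulate _<ᵇ_ 0 0 u))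
  where
  entry : ∀ t → (1 ℕ.≤ᵇ t) ∧ (atℕ u (suc t) <ᵇ atℕ u t) ≡ (letter 0 0 u (suc t) <ᵇ letter 0 0 u t)
  entry zero = refl
  entry (suc t) = cong₂ _<ᵇ_ (atℕ-letter u (suc (suc t))) (atℕ-letter u (suc t))

-- Entry i says whether letter i of the word x u (x being letter 0) is a peak;
-- `ascended` says whether x itself was reached by an ascent.
peaksAfter : Bool → ℕ → Vec ℕ k → Vec Bool k
peaksAfter ascended x [] = []
peaksAfter ascended x (z ∷ u) = (ascended ∧ (z <ᵇ x)) ∷ peaksAfter (x <ᵇ z) z u

isPeak : (ℕ → ℕ) → ℕ → Bool
isPeak s t = (s (t ∸ 1) <ᵇ s t) ∧ (s (suc t) <ᵇ s t)

peaksAfter-tabulate : (p x : ℕ) (u : Vec ℕ k) →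
  peaksAfter (p <ᵇ x) x u ≡ tabulate (λ i → isPeak (letter 0 p (x ∷ u)) (suc (toℕ i)))
peaksAfter-tabulate p x [] = refl
peaksAfter-tabulate p x (z ∷ u) = cong (_ ∷_) (peaksAfter-tabulate x z u)

Peak-peaksAfter : (u : Vec ℕ k) → Peak u ≡ peaksAfter true 0 u
Peak-peaksAfter [] = refl
Peak-peaksAfter (x ∷ u) =
  cong (false ∷_) (trans (tabulate-cong (λ i → isPeak-letter (suc (toℕ i)))) (sym (peaksAfter-tabulate 0 x u)))
  where
  isPeak-letter : ∀ t → isPeak (atℕ (x ∷ u)) t ≡ isPeak (letter 0 0 (x ∷ u)) t
  isPeak-letter t = cong₂ _∧_ (cong₂ _<ᵇ_ (atℕ-letter (x ∷ u) (t ∸ 1)) (atℕ-letter (x ∷ u) t))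
                              (cong₂ _<ᵇ_ (atℕ-letter (x ∷ u) (suc t)) (atℕ-letter (x ∷ u) t))

<ᵇ-asym : ∀ x z b → (z <ᵇ x) ∧ ((x <ᵇ z) ∧ b) ≡ false
<ᵇ-asym zero z b = refl
<ᵇ-asym (suc x) zero b = refl
<ᵇ-asym (suc x) (suc z) b = <ᵇ-asym x z b

noConsec-peaksAfter : (ascended : Bool) (x : ℕ) (u : Vec ℕ k) → noConsec (peaksAfter ascended x u) ≡ true
noConsec-peaksAfter a x [] = refl
noConsec-peaksAfter a x (z ∷ []) = refl
noConsec-peaksAfter a x (z ∷ y ∷ u) = cong₂ _∧_ (cong not (no-adjacent a)) (noConsec-peaksAfter (x <ᵇ z) z (y ∷ u))
  where
  no-adjacent : ∀ a → (a ∧ (z <ᵇ x)) ∧ ((x <ᵇ z) ∧ (y <ᵇ z)) ≡ false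
  no-adjacent false = refl
  no-adjacent true = <ᵇ-asym x z (y <ᵇ z)

inFn-Peak : (u : Vec ℕ k) → inFn (Peak u) ≡ true
inFn-Peak u = trans (cong inFn (Peak-peaksAfter u)) (inFn-peaksAfter u)
  where
  inFn-peaksAfter : (u : Vec ℕ k) → inFn (peaksAfter true 0 u) ≡ true
  inFn-peaksAfter [] = refl
  inFn-peaksAfter (x ∷ u) = noConsec-peaksAfter true 0 (x ∷ u)

changes : Bool → Vec Bool k → Vec Bool k
changes t [] = []
changes t (b ∷ J) = (b xor t) ∷ changes b J

△-shift : (J : Subset k) → J △ shift J ≡ changes false J
△-shift [] = refl
△-shift (j ∷ J) = cong (_ ∷_) (xor-init j J)
  where
  xor-init : ∀ {k} j (J : Subset k) → Vec.zipWith _xor_ J (Vec.init (j ∷ J)) ≡ changes j J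
  xor-init j [] = refl
  xor-init j (b ∷ J) = cong (_ ∷_) (xor-init b J)

weight : Vec Bool k → Vec Bool k → ℕ
weight [] [] = 1
weight (false ∷ F) (g ∷ G) = weight F G
weight (true ∷ F) (g ∷ G) = ⟦ g ⟧ * (2 * weight F G)

weight-spec : (F G : Vec Bool k) → weight F G ≡ ⟦ F ⊆ᵇ G ⟧ * 2 ^ ∣ F ∣
weight-spec [] [] = refl
weight-spec (false ∷ F) (g ∷ G) = weight-spec F G
weight-spec (true ∷ F) (false ∷ G) = refl
weight-spec (true ∷ F) (true ∷ G) = begin
  1 * (2 * weight F G)               ≡⟨ ℕ.*-identityˡ _ ⟩
  2 * weight F G                     ≡⟨ cong (2 *_) (weight-spec F G) ⟩
  2 * (⟦ F ⊆ᵇ G ⟧ * 2 ^ ∣ F ∣)       ≡⟨ ℕ*.x∙yz≈y∙xz 2 ⟦ F ⊆ᵇ G ⟧ _ ⟩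
  ⟦ F ⊆ᵇ G ⟧ * 2 ^ suc ∣ F ∣        ∎
  where open ≡-Reasoning

weight-free : (x : ℕ) (u : Vec ℕ k) (J : Subset k) (t : Bool) →
  weight (peaksAfter true x u) (changes false J) + weight (peaksAfter true x u) (changes true J)
    ≡ 2 * weight (peaksAfter false x u) (changes t J)
weight-free x [] [] t = refl
weight-free x (z ∷ u) (c ∷ J) t with z <ᵇ x
... | false = cong (_+_ W) (sym (ℕ.+-identityʳ W))
  where W = weight (peaksAfter (x <ᵇ z) z u) (changes c J)
weight-free x (z ∷ u) (true ∷ J) t | true = trans (ℕ.+-identityʳ _) (ℕ.+-identityʳ _)
weight-free x (z ∷ u) (false ∷ J) t | true = ℕ.+-identityʳ _

weight-ascent : ∀ {x z} → x < z → (t b : Bool) (u : Vec ℕ k) (J : Subset k) →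
  weight (peaksAfter true x (z ∷ u)) (changes t (b ∷ J)) ≡ weight (peaksAfter true z u) (changes b J)
weight-ascent x<z t b u J rewrite <ᵇ-false (ℕ.<⇒≤ x<z) | <ᵇ-true x<z = refl

weight-descent : ∀ {x z} → z < x → (t b : Bool) (u : Vec ℕ k) (J : Subset k) →
  weight (peaksAfter true x (z ∷ u)) (changes t (b ∷ J)) ≡ ⟦ b xor t ⟧ * (2 * weight (peaksAfter false z u) (changes b J))
weight-descent z<x t b u J rewrite <ᵇ-true z<x | <ᵇ-false (ℕ.<⇒≤ z<x) = refl


-- Words without repeated adjacent letters

Separated : ℕ → Vec ℕ k → Set
Separated x u = Linked _≢_ (x ∷ toList u)

peaksOfDescents : Bool → Vec Bool k → Vec Bool k
peaksOfDescents ascended [] = []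
peaksOfDescents ascended (d ∷ D) = (ascended ∧ d) ∷ peaksOfDescents (not d) D

<ᵇ-flip : ∀ {x z} → x ≢ z → (x <ᵇ z) ≡ not (z <ᵇ x)
<ᵇ-flip {x} {z} x≢z with ℕ.<-cmp x z
... | tri< x<z _ _ = trans (<ᵇ-true x<z) (cong not (sym (<ᵇ-false (ℕ.<⇒≤ x<z))))
... | tri≈ _ x≡z _ = contradiction x≡z x≢z
... | tri> _ _ z<x = trans (<ᵇ-false (ℕ.<⇒≤ z<x)) (cong not (sym (<ᵇ-true z<x)))

peaksAfter-descents : (ascended : Bool) (x : ℕ) (u : Vec ℕ k) → Separated x u →
  peaksAfter ascended x u ≡ peaksOfDescents ascended (descentsAfter _<ᵇ_ x u)
peaksAfter-descents a x [] _ = refl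
peaksAfter-descents a x (z ∷ u) (x≢z ∷ sep) =
  cong (_ ∷_) (trans (cong (λ a′ → peaksAfter a′ z u) (<ᵇ-flip x≢z)) (peaksAfter-descents _ z u sep))

Peak-DesA : (u : Vec ℕ k) → Separated 0 u → Peak u ≡ peaksOfDescents true (DesA u)
Peak-DesA u sep = begin
  Peak u                                                ≡⟨ Peak-peaksAfter u ⟩
  peaksAfter true 0 u                                   ≡⟨ peaksAfter-descents true 0 u sep ⟩
  peaksOfDescents true (descentsAfter _<ᵇ_ 0 u)         ≡⟨ cong (peaksOfDescents true) (DesA-descentsAfter u) ⟨
  peaksOfDescents true (DesA u)                         ∎
  where open ≡-Reasoning

elemᵇ-∈ : ∀ y (xs : List ℕ) → elemᵇ y xs ≡ true → y ∈ xs
elemᵇ-∈ y (x ∷ xs) e with y ℕ.≡ᵇ x in y≡ᵇx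
... | true = here (ℕ.≡ᵇ⇒≡ y x (Equivalence.from Bool.T-≡ y≡ᵇx))
... | false = there (elemᵇ-∈ y xs e)

allᵇ-∈ : (p : A → Bool) (xs : List A) → allᵇ p xs ≡ true → ∀ {y} → y ∈ xs → p y ≡ true
allᵇ-∈ p (x ∷ xs) e (here refl) = Bool.∧-conicalˡ (p x) _ e
allᵇ-∈ p (x ∷ xs) e (there y∈xs) = allᵇ-∈ p xs (Bool.∧-conicalʳ (p x) _ e) y∈xs

isPerm-∈ : {n : ℕ} (u : Vec ℕ n) → isPerm u ≡ true → (i : Fin n) → suc (toℕ i) ∈ toList u
isPerm-∈ {n} u e i = elemᵇ-∈ _ (toList u) (allᵇ-∈ _ (oneTo n) e (∈-map⁺ suc (∈-upTo⁺ (Fin.toℕ<n i))))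

injection-length : (f : Fin m → A) → (∀ {i j} → f i ≡ f j → i ≡ j) → {xs : List A} → (∀ i → f i ∈ xs) → m ≤ length xs
injection-length f f-injective {xs} f∈xs = Fin.injective⇒≤ index-injective
  where
  index-injective : ∀ {i j} → index (f∈xs i) ≡ index (f∈xs j) → i ≡ j
  index-injective {i} {j} eq =
    f-injective (trans (lookup-index (f∈xs i)) (trans (cong (List.lookup xs) eq) (sym (lookup-index (f∈xs j)))))

separated-or-covered : (x : ℕ) (u : Vec ℕ k) → Separated x u ⊎ Σ (List ℕ) (λ l → length l ≡ k × (x ∷ toList u) ⊆ l)
separated-or-covered x [] = inj₁ [-]
separated-or-covered x (z ∷ u) with x ℕ.≟ z
... | yes refl = inj₂ (toList (z ∷ u) , length-toList (z ∷ u) , λ { (here refl) → here refl ; (there p) → p })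
... | no x≢z with separated-or-covered z u
...   | inj₁ sep = inj₁ (x≢z ∷ sep)
...   | inj₂ (l , len , cover) = inj₂ (x ∷ l , cong suc len , λ { (here refl) → here refl ; (there p) → there (cover p) })

-- If 0 u had two equal adjacent letters, the n + 1 distinct letters 0, 1, …, n
-- would fit in a list of length n.
isPerm⇒separated : {n : ℕ} (u : Vec ℕ n) → isPerm u ≡ true → Separated 0 u
isPerm⇒separated {n} u e with separated-or-covered 0 u
... | inj₁ sep = sep
... | inj₂ (l , len , cover) =
  contradiction (subst (suc n ≤_) len (injection-length toℕ Fin.toℕ-injective (λ i → cover (mem i)))) ℕ.1+n≰n
  where
  mem : (i : Fin (suc n)) → toℕ i ∈ 0 ∷ toList u
  mem Fin.zero = here refl
  mem (Fin.suc i) = there (isPerm-∈ u e i)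


-- Signed lifts of a word

signed : Bool → ℕ → ℤ
signed false x = + x
signed true x = ℤ.- (+ x)

signed-<ᵇ-ascent : ∀ {x z} → x < z → ∀ s t → (signed s z <ℤᵇ signed t x) ≡ s
signed-<ᵇ-ascent {x} {suc z} x<z false false = <ᵇ-false (ℕ.<⇒≤ x<z)
signed-<ᵇ-ascent {zero} {suc z} _ false true = refl
signed-<ᵇ-ascent {suc x} {suc z} _ false true = refl
signed-<ᵇ-ascent {x} {suc z} _ true false = refl
signed-<ᵇ-ascent {zero} {suc z} _ true true = refl
signed-<ᵇ-ascent {suc x} {suc z} (s<s x<z) true true = <ᵇ-true x<z

signed-<ᵇ-descent : ∀ {x z} → z < x → ∀ s t → (signed s z <ℤᵇ signed t x) ≡ not t
signed-<ᵇ-descent {suc x} {z} z<x false false = <ᵇ-true z<x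
signed-<ᵇ-descent {suc x} {z} _ false true = refl
signed-<ᵇ-descent {suc x} {zero} _ true false = refl
signed-<ᵇ-descent {suc x} {suc z} _ true false = refl
signed-<ᵇ-descent {suc x} {zero} _ true true = refl
signed-<ᵇ-descent {suc x} {suc z} (s<s z<x) true true = <ᵇ-false (ℕ.<⇒≤ z<x)

∧-regroup : ∀ a b c d → (a ∧ c) ∧ (b ∧ d) ≡ b ∧ (a ∧ (c ∧ d))
∧-regroup true true c d = refl
∧-regroup true false c d = Bool.∧-zeroʳ c
∧-regroup false b c d = sym (Bool.∧-zeroʳ b)

module Lifts (n : ℕ) where

  -- These multiplicities are 1 on letters (words) over {1, …, n} and 0 otherwise;
  -- carrying them avoids proving that permutations use no other letters.
  letterMult : ℕ → ℕ
  letterMult = occurrences ℕ._≟_ (oneTo n)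

  wordMult : Vec ℕ k → ℕ
  wordMult {k} = occurrences _≟ʷ_ (allVecs (oneTo n) k)

  lifts : ℤ → Vec ℕ k → Subset k → ℕ
  lifts {k} p u J = ∑[ w ∈ allVecs (signedLetters n) k ]
    ⟦ does (descentsAfter _<ℤᵇ_ p w ≟ˢ J) ∧ does (absVec w ≟ʷ u) ⟧

  signedLetters-select : (z : ℕ) (g : ℤ → ℕ) →
    ∑[ a ∈ signedLetters n ] ⟦ does (ℤ.∣ a ∣ ℕ.≟ z) ⟧ * g a ≡ letterMult z * (g (signed false z) + g (signed true z))
  signedLetters-select z g = begin
    ∑[ a ∈ signedLetters n ] ⟦ does (ℤ.∣ a ∣ ℕ.≟ z) ⟧ * g a
      ≡⟨ ∑-++ (List.map (λ m → + m) (oneTo n)) (List.map -[1+_] (upTo n)) _ ⟩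
    ∑ (List.map (λ m → + m) (oneTo n)) h + ∑ (List.map -[1+_] (upTo n)) h
      ≡⟨ cong₂ _+_ (∑-map (λ m → + m) (oneTo n) h) (trans (∑-map -[1+_] (upTo n) h) (sym (∑-map suc (upTo n) _))) ⟩
    (∑[ m ∈ oneTo n ] ⟦ does (m ℕ.≟ z) ⟧ * g (signed false m)) + (∑[ m ∈ oneTo n ] ⟦ does (m ℕ.≟ z) ⟧ * g (signed true m))
      ≡⟨ cong₂ _+_ (∑-select ℕ._≟_ (oneTo n) z (λ m → g (signed false m)))
                   (∑-select ℕ._≟_ (oneTo n) z (λ m → g (signed true m))) ⟩
    letterMult z * g (signed false z) + letterMult z * g (signed true z)
      ≡⟨ ℕ.*-distribˡ-+ (letterMult z) _ _ ⟨
    letterMult z * (g (signed false z) + g (signed true z))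
      ∎
    where
    open ≡-Reasoning
    h : ℤ → ℕ
    h a = ⟦ does (ℤ.∣ a ∣ ℕ.≟ z) ⟧ * g a

  lifts-∷ : (p : ℤ) (z : ℕ) (u : Vec ℕ k) (b : Bool) (J : Subset k) →
    lifts p (z ∷ u) (b ∷ J)
      ≡ letterMult z * (⟦ does ((signed false z <ℤᵇ p) Bool.≟ b) ⟧ * lifts (signed false z) u J
                       + ⟦ does ((signed true z <ℤᵇ p) Bool.≟ b) ⟧ * lifts (signed true z) u J)
  lifts-∷ {k} p z u b J = begin
    lifts p (z ∷ u) (b ∷ J)
      ≡⟨ ∑-allVecs (signedLetters n) k _ ⟩
    ∑[ a ∈ signedLetters n ] ∑[ w ∈ allVecs (signedLetters n) k ] ⟦ (headBit a ∧ tailDes a w) ∧ (headAbs a ∧ tailAbs w) ⟧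
      ≡⟨ ∑-cong factor (signedLetters n) ⟩
    ∑[ a ∈ signedLetters n ] ⟦ headAbs a ⟧ * (⟦ headBit a ⟧ * lifts a u J)
      ≡⟨ signedLetters-select z (λ a → ⟦ headBit a ⟧ * lifts a u J) ⟩
    letterMult z * (⟦ headBit (signed false z) ⟧ * lifts (signed false z) u J + ⟦ headBit (signed true z) ⟧ * lifts (signed true z) u J)
      ∎
    where
    open ≡-Reasoning
    headBit : ℤ → Bool
    headBit a = does ((a <ℤᵇ p) Bool.≟ b)
    headAbs : ℤ → Bool
    headAbs a = does (ℤ.∣ a ∣ ℕ.≟ z)
    tailDes : ℤ → Vec ℤ k → Bool
    tailDes a w = does (descentsAfter _<ℤᵇ_ a w ≟ˢ J)
    tailAbs : Vec ℤ k → Bool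
    tailAbs w = does (absVec w ≟ʷ u)
    factor : ∀ a → ∑[ w ∈ allVecs (signedLetters n) k ] ⟦ (headBit a ∧ tailDes a w) ∧ (headAbs a ∧ tailAbs w) ⟧
                   ≡ ⟦ headAbs a ⟧ * (⟦ headBit a ⟧ * lifts a u J)
    factor a = begin
      ∑[ w ∈ allVecs (signedLetters n) k ] ⟦ (headBit a ∧ tailDes a w) ∧ (headAbs a ∧ tailAbs w) ⟧
        ≡⟨ ∑-cong (λ w → cong ⟦_⟧ (∧-regroup (headBit a) (headAbs a) (tailDes a w) (tailAbs w))) (allVecs (signedLetters n) k) ⟩
      ∑[ w ∈ allVecs (signedLetters n) k ] ⟦ headAbs a ∧ (headBit a ∧ (tailDes a w ∧ tailAbs w)) ⟧
        ≡⟨ ∑-cong (λ w → trans (⟦⟧-∧ (headAbs a) _) (cong (⟦ headAbs a ⟧ *_) (⟦⟧-∧ (headBit a) _))) (allVecs (signedLetters n) k) ⟩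
      ∑[ w ∈ allVecs (signedLetters n) k ] ⟦ headAbs a ⟧ * (⟦ headBit a ⟧ * ⟦ tailDes a w ∧ tailAbs w ⟧)
        ≡⟨ ∑-*ˡ ⟦ headAbs a ⟧ (allVecs (signedLetters n) k) _ ⟩
      ⟦ headAbs a ⟧ * (∑[ w ∈ allVecs (signedLetters n) k ] ⟦ headBit a ⟧ * ⟦ tailDes a w ∧ tailAbs w ⟧)
        ≡⟨ cong (⟦ headAbs a ⟧ *_) (∑-*ˡ ⟦ headBit a ⟧ (allVecs (signedLetters n) k) _) ⟩
      ⟦ headAbs a ⟧ * (⟦ headBit a ⟧ * lifts a u J)
        ∎

  wordMult-∷ : (z : ℕ) (u : Vec ℕ k) (w : ℕ) → letterMult z * (wordMult u * w) ≡ wordMult (z ∷ u) * w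
  wordMult-∷ {k} z u w =
    trans (sym (ℕ.*-assoc (letterMult z) (wordMult u) w)) (cong (_* w) (sym (occurrences-allVecs ℕ._≟_ (oneTo n) k z u)))

  lifts-ascent : ∀ {x z} → x < z → (t b : Bool) (u : Vec ℕ k) (J : Subset k) →
    lifts (signed t x) (z ∷ u) (b ∷ J) ≡ letterMult z * lifts (signed b z) u J
  lifts-ascent {x = x} {z} x<z t b u J =
    trans (lifts-∷ (signed t x) z u b J)
          (cong (letterMult z *_) (trans (cong₂ step (signed-<ᵇ-ascent x<z false t) (signed-<ᵇ-ascent x<z true t))
                                         (select-sign b)))
    where
    L : Bool → ℕ
    L s = lifts (signed s z) u J
    step : Bool → Bool → ℕ
    step e₀ e₁ = ⟦ does (e₀ Bool.≟ b) ⟧ * L false + ⟦ does (e₁ Bool.≟ b) ⟧ * L true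
    select-sign : ∀ b → ⟦ does (false Bool.≟ b) ⟧ * L false + ⟦ does (true Bool.≟ b) ⟧ * L true ≡ L b
    select-sign false = trans (ℕ.+-identityʳ _) (ℕ.+-identityʳ _)
    select-sign true = ℕ.+-identityʳ _

  lifts-descent : ∀ {x z} → z < x → (t b : Bool) (u : Vec ℕ k) (J : Subset k) →
    lifts (signed t x) (z ∷ u) (b ∷ J) ≡ letterMult z * (⟦ b xor t ⟧ * (lifts (signed false z) u J + lifts (signed true z) u J))
  lifts-descent {x = x} {z} z<x t b u J =
    trans (lifts-∷ (signed t x) z u b J)
          (cong (letterMult z *_) (trans (cong₂ step (signed-<ᵇ-descent z<x false t) (signed-<ᵇ-descent z<x true t))
                                         (trans (sym (ℕ.*-distribˡ-+ ⟦ does (not t Bool.≟ b) ⟧ _ _))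
                                                (cong (λ e → ⟦ e ⟧ * (L false + L true)) (≟-xor t b)))))
    where
    L : Bool → ℕ
    L s = lifts (signed s z) u J
    step : Bool → Bool → ℕ
    step e₀ e₁ = ⟦ does (e₀ Bool.≟ b) ⟧ * L false + ⟦ does (e₁ Bool.≟ b) ⟧ * L true
    ≟-xor : ∀ t b → does (not t Bool.≟ b) ≡ b xor t
    ≟-xor false false = refl
    ≟-xor false true = refl
    ≟-xor true false = refl
    ≟-xor true true = refl

  lifts-signed : (t : Bool) (x : ℕ) (u : Vec ℕ k) (J : Subset k) → Separated x u →
    lifts (signed t x) u J ≡ wordMult u * weight (peaksAfter true x u) (changes t J)
  lifts-signed t x [] [] [-] = refl
  lifts-signed t x (z ∷ u) (b ∷ J) (x≢z ∷ sep) with ℕ.<-cmp x z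
  ... | tri≈ _ x≡z _ = contradiction x≡z x≢z
  ... | tri< x<z _ _ = begin
    lifts (signed t x) (z ∷ u) (b ∷ J)
      ≡⟨ lifts-ascent x<z t b u J ⟩
    letterMult z * lifts (signed b z) u J
      ≡⟨ cong (letterMult z *_) (lifts-signed b z u J sep) ⟩
    letterMult z * (wordMult u * weight (peaksAfter true z u) (changes b J))
      ≡⟨ wordMult-∷ z u _ ⟩
    wordMult (z ∷ u) * weight (peaksAfter true z u) (changes b J)
      ≡⟨ cong (wordMult (z ∷ u) *_) (weight-ascent x<z t b u J) ⟨
    wordMult (z ∷ u) * weight (peaksAfter true x (z ∷ u)) (changes t (b ∷ J))
      ∎
    where open ≡-Reasoning
  ... | tri> _ _ z<x = begin
    lifts (signed t x) (z ∷ u) (b ∷ J)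
      ≡⟨ lifts-descent z<x t b u J ⟩
    letterMult z * (⟦ b xor t ⟧ * (lifts (signed false z) u J + lifts (signed true z) u J))
      ≡⟨ cong (λ e → letterMult z * (⟦ b xor t ⟧ * e)) either-sign ⟩
    letterMult z * (⟦ b xor t ⟧ * (wordMult u * (2 * W)))
      ≡⟨ cong (letterMult z *_) (ℕ*.x∙yz≈y∙xz ⟦ b xor t ⟧ (wordMult u) _) ⟩
    letterMult z * (wordMult u * (⟦ b xor t ⟧ * (2 * W)))
      ≡⟨ wordMult-∷ z u _ ⟩
    wordMult (z ∷ u) * (⟦ b xor t ⟧ * (2 * W))
      ≡⟨ cong (wordMult (z ∷ u) *_) (weight-descent z<x t b u J) ⟨
    wordMult (z ∷ u) * weight (peaksAfter true x (z ∷ u)) (changes t (b ∷ J))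
      ∎
    where
    open ≡-Reasoning
    W : ℕ
    W = weight (peaksAfter false z u) (changes b J)
    either-sign : lifts (signed false z) u J + lifts (signed true z) u J ≡ wordMult u * (2 * W)
    either-sign = begin
      lifts (signed false z) u J + lifts (signed true z) u J
        ≡⟨ cong₂ _+_ (lifts-signed false z u J sep) (lifts-signed true z u J sep) ⟩
      wordMult u * weight (peaksAfter true z u) (changes false J) + wordMult u * weight (peaksAfter true z u) (changes true J)
        ≡⟨ ℕ.*-distribˡ-+ (wordMult u) _ _ ⟨
      wordMult u * (weight (peaksAfter true z u) (changes false J) + weight (peaksAfter true z u) (changes true J))
        ≡⟨ cong (wordMult u *_) (weight-free z u J b) ⟩
      wordMult u * (2 * W)
        ∎


-- Coefficients of φ(Y_J), of the P_F and of the D_K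

module Coefficients (n : ℕ) where
  open Lifts n

  #perms : Vec ℕ n → ℕ
  #perms = occurrences _≟ʷ_ (Sn n)

  #perms-isPerm : (u : Vec ℕ n) → #perms u ≡ ⟦ isPerm u ⟧ * wordMult u
  #perms-isPerm u = occurrences-filter _≟ʷ_ (λ v → T? (isPerm v)) (allVecs (oneTo n) n) u

  coeffA-fibre : (f : Vec ℕ n → Subset k) (K : Subset k) (u : Vec ℕ n) →
    coeffA (sumOf (filter (λ v → f v ≟ˢ K) (Sn n))) u ≡ ℚ-ofℕ (⟦ does (f u ≟ˢ K) ⟧ * #perms u)
  coeffA-fibre f K u = trans (coeffA-sumOf (filter fibre? (Sn n)) u) (cong ℚ-ofℕ (occurrences-filter _≟ʷ_ fibre? (Sn n) u))
    where fibre? = λ v → f v ≟ˢ K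

  sameAbs-lifts : (J : Subset n) (u : Vec ℕ n) →
    ∑[ w ∈ filter (λ w → DesB w ≟ˢ J) (Bn n) ] ⟦ does (absVec w ≟ʷ u) ⟧ ≡ ⟦ isPerm u ⟧ * lifts (+ 0) u J
  sameAbs-lifts J u = begin
    ∑[ w ∈ filter DesB≟J (filter isPerm? W) ] ⟦ sameAbs w ⟧
      ≡⟨ ∑-filter DesB≟J (filter isPerm? W) _ ⟩
    ∑[ w ∈ filter isPerm? W ] ⟦ does (DesB≟J w) ⟧ * ⟦ sameAbs w ⟧
      ≡⟨ ∑-filter isPerm? W _ ⟩
    ∑[ w ∈ W ] ⟦ isPerm (absVec w) ⟧ * (⟦ does (DesB≟J w) ⟧ * ⟦ sameAbs w ⟧)
      ≡⟨ ∑-cong pointwise W ⟩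
    ∑[ w ∈ W ] ⟦ isPerm u ⟧ * ⟦ D₀ w ∧ sameAbs w ⟧
      ≡⟨ ∑-*ˡ ⟦ isPerm u ⟧ W _ ⟩
    ⟦ isPerm u ⟧ * lifts (+ 0) u J
      ∎
    where
    open ≡-Reasoning
    W = allVecs (signedLetters n) n
    DesB≟J = λ (w : Vec ℤ n) → DesB w ≟ˢ J
    isPerm? = λ (w : Vec ℤ n) → T? (isPerm (absVec w))
    D₀ sameAbs : Vec ℤ n → Bool
    D₀ w = does (descentsAfter _<ℤᵇ_ (+ 0) w ≟ˢ J)
    sameAbs w = does (absVec w ≟ʷ u)
    pointwise : ∀ w → ⟦ isPerm (absVec w) ⟧ * (⟦ does (DesB≟J w) ⟧ * ⟦ sameAbs w ⟧)
                      ≡ ⟦ isPerm u ⟧ * ⟦ D₀ w ∧ sameAbs w ⟧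
    pointwise w = begin
      ⟦ isPerm (absVec w) ⟧ * (⟦ does (DesB≟J w) ⟧ * ⟦ sameAbs w ⟧)
        ≡⟨ ℕ*.x∙yz≈z∙xy ⟦ isPerm (absVec w) ⟧ _ ⟦ sameAbs w ⟧ ⟩
      ⟦ sameAbs w ⟧ * (⟦ isPerm (absVec w) ⟧ * ⟦ does (DesB≟J w) ⟧)
        ≡⟨ ≟-select _≟ʷ_ (λ v → ⟦ isPerm v ⟧ * ⟦ does (DesB≟J w) ⟧) (absVec w) u ⟩
      ⟦ sameAbs w ⟧ * (⟦ isPerm u ⟧ * ⟦ does (DesB≟J w) ⟧)
        ≡⟨ ℕ*.x∙yz≈y∙zx ⟦ sameAbs w ⟧ ⟦ isPerm u ⟧ _ ⟩
      ⟦ isPerm u ⟧ * (⟦ does (DesB≟J w) ⟧ * ⟦ sameAbs w ⟧)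
        ≡⟨ cong (⟦ isPerm u ⟧ *_) (⟦⟧-∧ (does (DesB≟J w)) (sameAbs w)) ⟨
      ⟦ isPerm u ⟧ * ⟦ does (DesB≟J w) ∧ sameAbs w ⟧
        ≡⟨ cong (λ d → ⟦ isPerm u ⟧ * ⟦ does (d ≟ˢ J) ∧ sameAbs w ⟧) (DesB-descentsAfter w) ⟩
      ⟦ isPerm u ⟧ * ⟦ D₀ w ∧ sameAbs w ⟧
        ∎

  coeffA-φY : (J : Subset n) (u : Vec ℕ n) → coeffA (φ (Y J)) u ≡ ℚ-ofℕ (⟦ isPerm u ⟧ * lifts (+ 0) u J)
  coeffA-φY J u = begin
    coeffA (φ (Y J)) u
      ≡⟨ cong (λ x → coeffA x u) (φ-sumOf Yᴶ) ⟩
    coeffA (sumOf (List.map absVec Yᴶ)) u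
      ≡⟨ coeffA-sumOf (List.map absVec Yᴶ) u ⟩
    ℚ-ofℕ (occurrences _≟ʷ_ (List.map absVec Yᴶ) u)
      ≡⟨ cong ℚ-ofℕ (trans (∑-map absVec Yᴶ _) (sameAbs-lifts J u)) ⟩
    ℚ-ofℕ (⟦ isPerm u ⟧ * lifts (+ 0) u J)
      ∎
    where
    open ≡-Reasoning
    Yᴶ = filter (λ w → DesB w ≟ˢ J) (Bn n)

  coeffA-peakRHS : (J : Subset n) (u : Vec ℕ n) → coeffA (peakRHS J) u ≡ ℚ-ofℕ (weight (Peak u) (J △ shift J) * #perms u)
  coeffA-peakRHS J u = begin
    coeffA (peakRHS J) u
      ≡⟨ coeffA-combination (filter F? AS) (λ F → ℚ-ofℕ (2 ^ ∣ F ∣)) P u ⟩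
    ∑ℚ[ F ∈ filter F? AS ] ℚ-ofℕ (2 ^ ∣ F ∣) ℚ.* coeffA (P F) u
      ≡⟨ ∑ℚ-cong (λ F → trans (cong (ℚ-ofℕ (2 ^ ∣ F ∣) ℚ.*_) (coeffA-fibre Peak F u))
                              (sym (ℚ-ofℕ-* (2 ^ ∣ F ∣) _))) (filter F? AS) ⟩
    ∑ℚ[ F ∈ filter F? AS ] ℚ-ofℕ (2 ^ ∣ F ∣ * (⟦ does (Peak u ≟ˢ F) ⟧ * #perms u))
      ≡⟨ ∑ℚ-ofℕ (filter F? AS) _ ⟩
    ℚ-ofℕ (∑[ F ∈ filter F? AS ] 2 ^ ∣ F ∣ * (⟦ does (Peak u ≟ˢ F) ⟧ * #perms u))
      ≡⟨ cong ℚ-ofℕ count ⟩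
    ℚ-ofℕ (weight (Peak u) G * #perms u)
      ∎
    where
    open ≡-Reasoning
    AS = allSubsets n
    G = J △ shift J
    F? = λ (F : Subset n) → T? (inFn F ∧ (F ⊆ᵇ G))
    h : Subset n → ℕ
    h F = ⟦ inFn F ∧ (F ⊆ᵇ G) ⟧ * 2 ^ ∣ F ∣ * #perms u
    regroup : ∀ a b c d → a * (b * (c * d)) ≡ c * (a * b * d)
    regroup a b c d = trans (cong (a *_) (ℕ*.x∙yz≈y∙xz b c d)) (trans (ℕ*.x∙yz≈y∙xz a c _) (cong (c *_) (sym (ℕ.*-assoc a b d))))
    count : ∑[ F ∈ filter F? AS ] 2 ^ ∣ F ∣ * (⟦ does (Peak u ≟ˢ F) ⟧ * #perms u) ≡ weight (Peak u) G * #perms u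
    count = begin
      ∑[ F ∈ filter F? AS ] 2 ^ ∣ F ∣ * (⟦ does (Peak u ≟ˢ F) ⟧ * #perms u)
        ≡⟨ ∑-filter F? AS _ ⟩
      ∑[ F ∈ AS ] ⟦ inFn F ∧ (F ⊆ᵇ G) ⟧ * (2 ^ ∣ F ∣ * (⟦ does (Peak u ≟ˢ F) ⟧ * #perms u))
        ≡⟨ ∑-cong (λ F → regroup ⟦ inFn F ∧ (F ⊆ᵇ G) ⟧ (2 ^ ∣ F ∣) ⟦ does (Peak u ≟ˢ F) ⟧ (#perms u)) AS ⟩
      ∑[ F ∈ AS ] ⟦ does (Peak u ≟ˢ F) ⟧ * h F
        ≡⟨ allSubsets-select (Peak u) h ⟩
      ⟦ inFn (Peak u) ∧ (Peak u ⊆ᵇ G) ⟧ * 2 ^ ∣ Peak u ∣ * #perms u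
        ≡⟨ cong (λ b → ⟦ b ∧ (Peak u ⊆ᵇ G) ⟧ * 2 ^ ∣ Peak u ∣ * #perms u) (inFn-Peak u) ⟩
      ⟦ Peak u ⊆ᵇ G ⟧ * 2 ^ ∣ Peak u ∣ * #perms u
        ≡⟨ cong (_* #perms u) (weight-spec (Peak u) G) ⟨
      weight (Peak u) G * #perms u
        ∎

  lifts-Peak : (J : Subset k) (u : Vec ℕ k) → Separated 0 u → lifts (+ 0) u J ≡ wordMult u * weight (Peak u) (J △ shift J)
  lifts-Peak J u sep =
    trans (lifts-signed false 0 u J sep) (cong₂ (λ F G → wordMult u * weight F G) (sym (Peak-peaksAfter u)) (sym (△-shift J)))

  lifts-perm : (J : Subset n) (u : Vec ℕ n) → ⟦ isPerm u ⟧ * lifts (+ 0) u J ≡ weight (Peak u) (J △ shift J) * #perms u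
  lifts-perm J u = trans (by-isPerm (isPerm u) refl) (cong (weight (Peak u) (J △ shift J) *_) (sym (#perms-isPerm u)))
    where
    open ≡-Reasoning
    by-isPerm : ∀ b → isPerm u ≡ b → ⟦ b ⟧ * lifts (+ 0) u J ≡ weight (Peak u) (J △ shift J) * (⟦ b ⟧ * wordMult u)
    by-isPerm false _ = sym (ℕ.*-zeroʳ (weight (Peak u) (J △ shift J)))
    by-isPerm true perm = begin
      1 * lifts (+ 0) u J                                ≡⟨ ℕ.*-identityˡ _ ⟩
      lifts (+ 0) u J                                    ≡⟨ lifts-Peak J u (isPerm⇒separated u perm) ⟩
      wordMult u * weight (Peak u) (J △ shift J)         ≡⟨ ℕ.*-comm (wordMult u) _ ⟩
      weight (Peak u) (J △ shift J) * wordMult u         ≡⟨ cong (weight (Peak u) (J △ shift J) *_) (ℕ.*-identityˡ _) ⟨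
      weight (Peak u) (J △ shift J) * (1 * wordMult u)   ∎

  φY≈peakRHS : (J : Subset n) → φ (Y J) ≈A peakRHS J
  φY≈peakRHS J u = begin
    coeffA (φ (Y J)) u                                          ≡⟨ coeffA-φY J u ⟩
    ℚ-ofℕ (⟦ isPerm u ⟧ * lifts (+ 0) u J)                      ≡⟨ cong ℚ-ofℕ (lifts-perm J u) ⟩
    ℚ-ofℕ (weight (Peak u) (J △ shift J) * #perms u)            ≡⟨ coeffA-peakRHS J u ⟨
    coeffA (peakRHS J) u                                        ∎
    where open ≡-Reasoning

  peakCoefficient : (Subset n → ℚ) → Subset n → ℚ
  peakCoefficient a F = ∑ℚ[ J ∈ allSubsets n ] a J ℚ.* ℚ-ofℕ (weight F (J △ shift J))

  coeffA-φΣB : (a : Subset n → ℚ) (u : Vec ℕ n) → coeffA (φ (ΣB-elem a)) u ≡ peakCoefficient a (Peak u) ℚ.* ℚ-ofℕ (#perms u)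
  coeffA-φΣB a u = begin
    coeffA (φ (ΣB-elem a)) u
      ≡⟨ cong (λ x → coeffA x u) (φ-combination AS a Y) ⟩
    coeffA (sumF AS (λ J → scale (a J) (φ (Y J)))) u
      ≡⟨ coeffA-combination AS a (λ J → φ (Y J)) u ⟩
    ∑ℚ[ J ∈ AS ] a J ℚ.* coeffA (φ (Y J)) u
      ≡⟨ ∑ℚ-cong (λ J → cong (a J ℚ.*_) (trans (φY≈peakRHS J u) (coeffA-peakRHS J u))) AS ⟩
    ∑ℚ[ J ∈ AS ] a J ℚ.* ℚ-ofℕ (weight (Peak u) (J △ shift J) * #perms u)
      ≡⟨ ∑ℚ-cong (λ J → trans (cong (a J ℚ.*_) (ℚ-ofℕ-* (weight (Peak u) (J △ shift J)) (#perms u)))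
                              (sym (ℚ.*-assoc (a J) _ _))) AS ⟩
    ∑ℚ[ J ∈ AS ] a J ℚ.* ℚ-ofℕ (weight (Peak u) (J △ shift J)) ℚ.* ℚ-ofℕ (#perms u)
      ≡⟨ ∑ℚ-*ʳ (ℚ-ofℕ (#perms u)) AS _ ⟩
    peakCoefficient a (Peak u) ℚ.* ℚ-ofℕ (#perms u)
      ∎
    where
    open ≡-Reasoning
    AS = allSubsets n

  coeffA-D-combination : (c : Subset n → ℚ) (u : Vec ℕ n) →
    coeffA (sumF (allSubsets n) (λ K → scale (c K) (D K))) u ≡ c (DesA u) ℚ.* ℚ-ofℕ (#perms u)
  coeffA-D-combination c u = begin
    coeffA (sumF AS (λ K → scale (c K) (D K))) u
      ≡⟨ coeffA-combination AS c D u ⟩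
    ∑ℚ[ K ∈ AS ] c K ℚ.* coeffA (D K) u
      ≡⟨ ∑ℚ-cong (λ K → cong (c K ℚ.*_) (coeffA-fibre DesA K u)) AS ⟩
    ∑ℚ[ K ∈ AS ] c K ℚ.* ℚ-ofℕ (⟦ does (DesA u ≟ˢ K) ⟧ * #perms u)
      ≡⟨ ∑ℚ-cong (λ K → trans (cong (c K ℚ.*_) (ℚ-ofℕ-* ⟦ does (DesA u ≟ˢ K) ⟧ (#perms u)))
                              (ℚ*.x∙yz≈y∙xz (c K) (ℚ-ofℕ ⟦ does (DesA u ≟ˢ K) ⟧) _)) AS ⟩
    ∑ℚ[ K ∈ AS ] ℚ-ofℕ ⟦ does (DesA u ≟ˢ K) ⟧ ℚ.* (c K ℚ.* ℚ-ofℕ (#perms u))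
      ≡⟨ allSubsets-selectℚ (DesA u) (λ K → c K ℚ.* ℚ-ofℕ (#perms u)) ⟩
    c (DesA u) ℚ.* ℚ-ofℕ (#perms u)
      ∎
    where
    open ≡-Reasoning
    AS = allSubsets n

  Peak-DesA-on-perms : (u : Vec ℕ n) → #perms u ≡ 0 ⊎ Peak u ≡ peaksOfDescents true (DesA u)
  Peak-DesA-on-perms u with isPerm u in perm
  ... | true = inj₂ (Peak-DesA u (isPerm⇒separated u perm))
  ... | false = inj₁ (trans (#perms-isPerm u) (cong (λ b → ⟦ b ⟧ * wordMult u) perm))

  φΣB≈D-combination : (a : Subset n → ℚ) →
    φ (ΣB-elem a) ≈A sumF (allSubsets n) (λ K → scale (peakCoefficient a (peaksOfDescents true K)) (D K))
  φΣB≈D-combination a u = begin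
    coeffA (φ (ΣB-elem a)) u                      ≡⟨ coeffA-φΣB a u ⟩
    S (Peak u) ℚ.* ℚ-ofℕ (#perms u)               ≡⟨ agree (Peak-DesA-on-perms u) ⟩
    S (peaksOfDescents true (DesA u)) ℚ.* ℚ-ofℕ (#perms u)
                                                  ≡⟨ coeffA-D-combination (λ K → S (peaksOfDescents true K)) u ⟨
    coeffA (sumF (allSubsets n) (λ K → scale (S (peaksOfDescents true K)) (D K))) u ∎
    where
    open ≡-Reasoning
    S = peakCoefficient a
    agree : #perms u ≡ 0 ⊎ Peak u ≡ peaksOfDescents true (DesA u) →
      S (Peak u) ℚ.* ℚ-ofℕ (#perms u) ≡ S (peaksOfDescents true (DesA u)) ℚ.* ℚ-ofℕ (#perms u)
    agree (inj₁ none) rewrite none = trans (ℚ.*-zeroʳ (S (Peak u))) (sym (ℚ.*-zeroʳ (S (peaksOfDescents true (DesA u)))))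
    agree (inj₂ same) = cong (λ F → S F ℚ.* ℚ-ofℕ (#perms u)) same

proposition3p2 : (n : ℕ) → 1 ≤ n →
    ((J : Subset n) → φ (Y J) ≈A peakRHS J)
    × ((a : Subset n → ℚ) → InΣA (φ (ΣB-elem a)))
proposition3p2 n _ = φY≈peakRHS , λ a → (λ K → peakCoefficient a (peaksOfDescents true K)) , φΣB≈D-combination a
  where open Coefficients n
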